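{- The derivative $\partial w$ of every proper Christoffel word $w$ over $\{a,b\}$ is a Christoffel word.
   Context: Alphabet $\mathcal A=\{a,b\}$. The right palindromic closure $u^{(+)}$ of a word $u$ is the shortest palindrome having $u$ as a prefix. The palindromization map $\psi:\mathcal A^*\to\mathcal A^*$ is defined by $\psi(\varepsilon)=\varepsilon$ and $\psi(ux)=(\psi(u)x)^{(+)}$ for $u\in\mathcal A^*$, $x\in\mathcal A$; it is injective. A Christoffel word is either a single letter $a$ or $b$, or a word of the form $a\psi(v)b$ with $v\in\mathcal A^*$; the latter are called proper Christoffel words. Every nonempty $v$ is uniquely written $v=x_0^{\alpha_0}x_1^{\alpha_1}\cdots x_n^{\alpha_n}$ with $x_i\in\mathcal A$, $\alpha_i\ge1$, $x_{i+1}\neq x_i$. The index of $\psi(v)$ (and of the Christoffel word $a\psi(v)b$) is $0$ if $v=\varepsilon$ and $\alpha_0$ otherwise. For $k\ge0$ let $\varphi_k$ be the morphism $a\mapsto a^{k+1}b$, $b\mapsto a^kb$ and $\hat\varphi_k$ the morphism $a\mapsto ab^k$, $b\mapsto ab^{k+1}$ (both injective). Derivative: for a proper Christoffel word $w=a\psi(v)b$ of index $k$: if $k=0$ (i.e. $w=ab$), $\partial w=a$; if $k>0$ and $v$ begins with $a$, then $w\in\{a^kb,a^{k+1}b\}^*$ and $\partial w=\varphi_k^{ -1}(w)$ (the unique word $u$ with $\varphi_k(u)=w$); if $k>0$ and $v$ begins with $b$, then $w\in\{ab^k,ab^{k+1}\}^*$ and $\partial w=\hat\varphi_k^{ -1}(w)$.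 -}

module Defs where

open import Data.Nat using (ℕ; zero; suc)
open import Data.List using (List; []; _∷_; _++_; [_]; reverse; take; length; replicate; concatMap)
open import Data.Product using (Σ; ∃; _×_; _,_)
open import Data.Sum using (_⊎_)
open import Relation.Binary.PropositionalEquality using (_≡_)
open import Relation.Nullary using (Dec; yes; no)
open import Relation.Nullary.Decidable using (⌊_⌋)
open import Data.Bool using (Bool; true; false; if_then_else_)

data Letter : Set where
  a b : Letter

_≟L_ : (x y : Letter) → Dec (x ≡ y)
a ≟L a = yes _≡_.refl
a ≟L b = no λ ()
b ≟L a = no λ ()
b ≟L b = yes _≡_.refl

Word : Set
Word = List Letter

eqW : Word → Word → Bool
eqW [] [] = true
eqW [] (_ ∷ _) = false
eqW (_ ∷ _) [] = false
eqW (x ∷ xs) (y ∷ ys) = if ⌊ x ≟L y ⌋ then eqW xs ys else false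

isPal : Word → Bool
isPal w = eqW w (reverse w)

-- Right palindromic closure u⁽⁺⁾: the shortest palindrome with prefix u.
-- Any palindrome of length |u|+k (k ≤ |u|) having u as a prefix equals
-- u ++ reverse (take k u); and u ++ reverse u is always a palindrome.
closureFrom : Word → ℕ → ℕ → Word
closureFrom u k zero = u ++ reverse (take k u)
closureFrom u k (suc fuel) =
  if isPal (u ++ reverse (take k u)) then u ++ reverse (take k u)
  else closureFrom u (suc k) fuel

palClosure : Word → Word
palClosure u = closureFrom u 0 (length u)

-- Palindromization map ψ, defined on the reversed word so that
-- ψ (u ++ [x]) = palClosure (ψ u ++ [x]).
ψrev : Word → Word
ψrev [] = []
ψrev (x ∷ ru) = palClosure (ψrev ru ++ [ x ])

ψ : Word → Word
ψ v = ψrev (reverse v)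

IsChristoffel : Word → Set
IsChristoffel w = (w ≡ [ a ]) ⊎ (w ≡ [ b ]) ⊎ (∃ λ v → w ≡ a ∷ ψ v ++ [ b ])

runLength : Letter → Word → ℕ
runLength x [] = 0
runLength x (y ∷ ys) = if ⌊ x ≟L y ⌋ then suc (runLength x ys) else 0

index : Word → ℕ
index [] = 0
index (x ∷ xs) = runLength x (x ∷ xs)

φimg : ℕ → Letter → Word
φimg k a = replicate (suc k) a ++ [ b ]
φimg k b = replicate k a ++ [ b ]

φ : ℕ → Word → Word
φ k = concatMap (φimg k)

φ̂img : ℕ → Letter → Word
φ̂img k a = a ∷ replicate k b
φ̂img k b = a ∷ replicate (suc k) b

φ̂ : ℕ → Word → Word
φ̂ k = concatMap (φ̂img k)

-- The derivative relation: IsDerivative v d means d = ∂(a ψ(v) b).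
-- (φ_k, φ̂_k are injective, so d is determined uniquely.)
IsDerivative : Word → Word → Set
IsDerivative [] d = d ≡ [ a ]
IsDerivative (a ∷ v) d = φ (index (a ∷ v)) d ≡ a ∷ ψ (a ∷ v) ++ [ b ]
IsDerivative (b ∷ v) d = φ̂ (index (b ∷ v)) d ≡ a ∷ ψ (b ∷ v) ++ [ b ]

module Submission where

-- Let μ_x fix x and send the other letter y to xy, and let μ̃_x send y to yx. The map
-- w ↦ μ_x(w)x carries the longest palindromic suffix of w to that of its image, hence
-- commutes with palindromic closure; this yields Justin's formula ψ(xv) = μ_x(ψ v)x, i.e.
-- aψ(av)b = μ_a(aψ(v)b) and aψ(bv)b = μ̃_b(aψ(v)b). Writing v = aᵏu with u empty or
-- u = bu′, and noting φ_k = μ_aᵏ ∘ μ̃_b, we get aψ(v)b = φ_k(d) with d = a or d = aψ(u′)b.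
-- The case v = bᵏu is symmetric, with φ̂_k = μ̃_bᵏ ∘ μ_a.

open import Defs
open import Data.Product using (∃; ∃₂; _×_; _,_)
open import Data.Nat using (ℕ; zero; suc; _+_; _⊓_; _≤_; _<_; z≤n; _≟_)
open import Data.Nat.Properties using (≤-refl; ≤-antisym; <⇒≤; ≤∧≢⇒<; <⇒≱; module ≤-Reasoning; +-identityʳ; +-suc; m≤m+n; m⊓n≤m)
open import Data.Nat.GeneralisedArithmetic using (fold)
open import Data.List using ([]; _∷_; _++_; [_]; reverse; take; drop; length; concatMap; replicate)
open import Data.List.Properties using (++-assoc; ++-identityʳ; reverse-++; reverse-involutive; unfold-reverse; take++drop≡id; length-take; length-++; ∷-injectiveˡ; ∷-injectiveʳ; ∷ʳ-injectiveˡ; ++-cancelˡ; ++-cancelʳ; ≡-dec; concatMap-++; reverse-injective; ++-identityʳ-unique)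
open import Data.Sum using (inj₁; inj₂)
open import Data.Empty using (⊥-elim)
open import Data.Bool using (true; false)
open import Relation.Nullary using (yes; no; ¬_)
open import Function using (_∘_)
open import Relation.Binary.PropositionalEquality using (_≡_; refl; sym; trans; cong; cong₂; subst; module ≡-Reasoning)

take-length-++ : ∀ (t s : Word) → take (length t) (t ++ s) ≡ t
take-length-++ []      s = refl
take-length-++ (x ∷ t) s = cong (x ∷_) (take-length-++ t s)

length-≤-take : ∀ {j} {w : Word} t r → take j w ≡ t ++ r → length t ≤ j
length-≤-take {j} {w} t r eq = begin
  length t                ≤⟨ m≤m+n (length t) (length r) ⟩
  length t + length r     ≡⟨ length-++ t ⟨
  length (t ++ r)         ≡⟨ cong length eq ⟨
  length (take j w)       ≡⟨ length-take j w ⟩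
  j ⊓ length w            ≤⟨ m⊓n≤m j (length w) ⟩
  j                       ∎
  where open ≤-Reasoning

nonempty-suffix : ∀ (t : Word) c r → ¬ [] ≡ t ++ c ∷ r
nonempty-suffix []      _ _ ()
nonempty-suffix (_ ∷ _) _ _ ()

∷-suffix : ∀ (x : Letter) u v m → x ∷ u ≡ m ++ x ∷ v → ∃ λ r → u ≡ r ++ v
∷-suffix x u v []      eq = [] , ∷-injectiveʳ eq
∷-suffix x u v (_ ∷ m) eq = m ++ [ x ] , trans (∷-injectiveʳ eq) (sym (++-assoc m [ x ] v))

replicate-∷ʳ : ∀ k (x : Letter) → replicate k x ++ [ x ] ≡ x ∷ replicate k x
replicate-∷ʳ zero    x = refl
replicate-∷ʳ (suc k) x = cong (x ∷_) (replicate-∷ʳ k x)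

reverse-concatMap : ∀ (f : Letter → Word) w → reverse (concatMap f w) ≡ concatMap (reverse ∘ f) (reverse w)
reverse-concatMap f []      = refl
reverse-concatMap f (c ∷ w) = begin
  reverse (f c ++ concatMap f w)                     ≡⟨ reverse-++ (f c) (concatMap f w) ⟩
  reverse (concatMap f w) ++ reverse (f c)           ≡⟨ cong₂ _++_ (reverse-concatMap f w) (sym (++-identityʳ (reverse (f c)))) ⟩
  concatMap g (reverse w) ++ concatMap g [ c ]       ≡⟨ concatMap-++ g (reverse w) [ c ] ⟨
  concatMap g (reverse w ++ [ c ])                   ≡⟨ cong (concatMap g) (unfold-reverse c w) ⟨
  concatMap g (reverse (c ∷ w))                      ∎
  where
  open ≡-Reasoning
  g = reverse ∘ f

Pal : Word → Set
Pal w = reverse w ≡ w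

eqW-refl : ∀ w → eqW w w ≡ true
eqW-refl []      = refl
eqW-refl (a ∷ w) = eqW-refl w
eqW-refl (b ∷ w) = eqW-refl w

eqW-sound : ∀ u w → eqW u w ≡ true → u ≡ w
eqW-sound []      []       _ = refl
eqW-sound (a ∷ u) (a ∷ w) eq = cong (a ∷_) (eqW-sound u w eq)
eqW-sound (b ∷ u) (b ∷ w) eq = cong (b ∷_) (eqW-sound u w eq)
eqW-sound []      (_ ∷ _) ()
eqW-sound (_ ∷ _) []      ()
eqW-sound (a ∷ u) (b ∷ w) ()
eqW-sound (b ∷ u) (a ∷ w) ()

isPal-sound : ∀ w → isPal w ≡ true → Pal w
isPal-sound w eq = sym (eqW-sound w (reverse w) eq)

isPal-complete : ∀ w → Pal w → isPal w ≡ true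
isPal-complete w pal = subst (λ r → eqW w r ≡ true) (sym pal) (eqW-refl w)

pal-++-reverse : ∀ t s → Pal s → Pal ((t ++ s) ++ reverse t)
pal-++-reverse t s pal = begin
  reverse ((t ++ s) ++ reverse t)          ≡⟨ reverse-++ (t ++ s) (reverse t) ⟩
  reverse (reverse t) ++ reverse (t ++ s)  ≡⟨ cong₂ _++_ (reverse-involutive t) (reverse-++ t s) ⟩
  t ++ reverse s ++ reverse t              ≡⟨ cong (λ r → t ++ r ++ reverse t) pal ⟩
  t ++ s ++ reverse t                      ≡⟨ ++-assoc t s (reverse t) ⟨
  (t ++ s) ++ reverse t                    ∎
  where open ≡-Reasoning

pal-++-reverse⁻¹ : ∀ t s → Pal ((t ++ s) ++ reverse t) → Pal s
pal-++-reverse⁻¹ t s pal =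
  ++-cancelʳ (reverse t) (reverse s) s (++-cancelˡ t (reverse s ++ reverse t) (s ++ reverse t) (begin
    t ++ reverse s ++ reverse t              ≡⟨ cong₂ _++_ (reverse-involutive t) (reverse-++ t s) ⟨
    reverse (reverse t) ++ reverse (t ++ s)  ≡⟨ reverse-++ (t ++ s) (reverse t) ⟨
    reverse ((t ++ s) ++ reverse t)          ≡⟨ pal ⟩
    (t ++ s) ++ reverse t                    ≡⟨ ++-assoc t s (reverse t) ⟩
    t ++ s ++ reverse t                      ∎))
  where open ≡-Reasoning

reverse-wrap : ∀ x (s : Word) → reverse (x ∷ s ++ [ x ]) ≡ x ∷ reverse s ++ [ x ]
reverse-wrap x s = trans (reverse-++ (x ∷ s) [ x ]) (cong (x ∷_) (unfold-reverse x s))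

pal-wrap : ∀ x (s : Word) → Pal s → Pal (x ∷ s ++ [ x ])
pal-wrap x s pal = trans (reverse-wrap x s) (cong (λ r → x ∷ r ++ [ x ]) pal)

pal-unwrap : ∀ x (s : Word) → Pal (x ∷ s ++ [ x ]) → Pal s
pal-unwrap x s pal = ∷ʳ-injectiveˡ (reverse s) s (∷-injectiveʳ (trans (sym (reverse-wrap x s)) pal))

palSuffix-head : ∀ u x t c r → u ++ [ x ] ≡ t ++ c ∷ r → Pal (c ∷ r) → c ≡ x
palSuffix-head u x t c r eq pal = sym (∷-injectiveˡ (begin
  x ∷ reverse u                 ≡⟨ reverse-++ u [ x ] ⟨
  reverse (u ++ [ x ])          ≡⟨ cong reverse eq ⟩
  reverse (t ++ c ∷ r)          ≡⟨ reverse-++ t (c ∷ r) ⟩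
  reverse (c ∷ r) ++ reverse t  ≡⟨ cong (_++ reverse t) pal ⟩
  c ∷ r ++ reverse t            ∎))
  where open ≡-Reasoning

-- Palindromic closure

candidate : Word → ℕ → Word
candidate u k = u ++ reverse (take k u)

closureFrom-first : ∀ u fuel k j → k ≤ j → j ≤ k + fuel → Pal (candidate u j) →
                    (∀ i → k ≤ i → i < j → ¬ Pal (candidate u i)) →
                    closureFrom u k fuel ≡ candidate u j
closureFrom-first u zero k j k≤j j≤k _ _
  rewrite ≤-antisym k≤j (subst (j ≤_) (+-identityʳ k) j≤k) = refl
closureFrom-first u (suc fuel) k j k≤j j≤k palj earlier with k ≟ j
... | yes refl rewrite isPal-complete (candidate u k) palj = refl
... | no k≢j with isPal (candidate u k) in eq
...   | true  = ⊥-elim (earlier k ≤-refl (≤∧≢⇒< k≤j k≢j) (isPal-sound _ eq))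
...   | false = closureFrom-first u fuel (suc k) j (≤∧≢⇒< k≤j k≢j) (subst (j ≤_) (+-suc k fuel) j≤k)
                  palj (λ i k<i → earlier i (<⇒≤ k<i))

record LongestPalSuffix (w t s : Word) : Set where
  field
    split      : w ≡ t ++ s
    palindrome : Pal s
    longest    : ∀ t′ s′ → w ≡ t′ ++ s′ → Pal s′ → ∃ λ r → s ≡ r ++ s′

candidate-pal⇒drop-pal : ∀ w j → Pal (candidate w j) → Pal (drop j w)
candidate-pal⇒drop-pal w j pal = pal-++-reverse⁻¹ (take j w) (drop j w)
  (subst (λ v → Pal (v ++ reverse (take j w))) (sym (take++drop≡id j w)) pal)

palClosure-longestPalSuffix : ∀ {w t s} → LongestPalSuffix w t s → palClosure w ≡ t ++ s ++ reverse t
palClosure-longestPalSuffix {w} {t} {s} lps = begin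
  closureFrom w 0 (length w)     ≡⟨ closureFrom-first w (length w) 0 (length t) z≤n t≤w palₜ shorter ⟩
  candidate w (length t)         ≡⟨ cong (λ v → v ++ reverse (take (length t) v)) split ⟩
  candidate (t ++ s) (length t)  ≡⟨ cong (λ r → (t ++ s) ++ reverse r) (take-length-++ t s) ⟩
  (t ++ s) ++ reverse t          ≡⟨ ++-assoc t s (reverse t) ⟩
  t ++ s ++ reverse t            ∎
  where
  open ≡-Reasoning
  open LongestPalSuffix lps
  t≤w : length t ≤ length w
  t≤w = subst (length t ≤_) (sym (trans (cong length split) (length-++ t))) (m≤m+n _ _)
  palₜ : Pal (candidate w (length t))
  palₜ = subst (λ v → Pal (v ++ reverse (take (length t) v))) (sym split)
           (subst (λ r → Pal ((t ++ s) ++ reverse r)) (sym (take-length-++ t s)) (pal-++-reverse t s palindrome))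
  -- A palindromic candidate j makes drop j w a palindromic suffix, hence a suffix of s, so t is a prefix of take j w.
  shorter : ∀ j → 0 ≤ j → j < length t → ¬ Pal (candidate w j)
  shorter j _ j<t pal with longest (take j w) (drop j w) (sym (take++drop≡id j w))
                                (candidate-pal⇒drop-pal w j pal)
  ... | r , s≡r++d = <⇒≱ j<t (length-≤-take t r prefix)
    where
    prefix : take j w ≡ t ++ r
    prefix = ++-cancelʳ (drop j w) (take j w) (t ++ r) (begin
      take j w ++ drop j w  ≡⟨ take++drop≡id j w ⟩
      w                     ≡⟨ split ⟩
      t ++ s                ≡⟨ cong (t ++_) s≡r++d ⟩
      t ++ r ++ drop j w    ≡⟨ ++-assoc t r (drop j w) ⟨
      (t ++ r) ++ drop j w  ∎)

longestPalSuffix : ∀ w → ∃₂ λ t s → LongestPalSuffix w t s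
longestPalSuffix [] = [] , [] , record { split = refl ; palindrome = refl ; longest = longest }
  where
  longest : ∀ t′ s′ → [] ≡ t′ ++ s′ → Pal s′ → ∃ λ r → [] ≡ r ++ s′
  longest [] [] refl _ = [] , refl
longestPalSuffix (c ∷ w) with ≡-dec _≟L_ (reverse (c ∷ w)) (c ∷ w)
... | yes pal = [] , c ∷ w , record { split = refl ; palindrome = pal ; longest = λ t′ _ eq _ → t′ , eq }
... | no ¬pal with longestPalSuffix w
...   | t , s , lps = c ∷ t , s , record { split = cong (c ∷_) split ; palindrome = palindrome ; longest = longest′ }
  where
  open LongestPalSuffix lps
  longest′ : ∀ t′ s′ → c ∷ w ≡ t′ ++ s′ → Pal s′ → ∃ λ r → s ≡ r ++ s′
  longest′ []       _ refl pal = ⊥-elim (¬pal pal)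
  longest′ (_ ∷ t′) s′ eq pal = longest t′ s′ (∷-injectiveʳ eq) pal

longestPalSuffix-∷ʳ : ∀ {p y t s} → LongestPalSuffix (p ++ [ y ]) t s → ∃ λ s′ → s ≡ y ∷ s′
longestPalSuffix-∷ʳ {p} {y} {t} {s} lps with LongestPalSuffix.longest lps p [ y ] refl refl
... | r , s≡ = reverse r , trans (sym (LongestPalSuffix.palindrome lps)) (trans (cong reverse s≡) (reverse-++ r [ y ]))

-- The morphisms μ_x and μ̃_x

other : Letter → Letter
other a = b
other b = a

μimg : Letter → Letter → Word
μimg a a = a ∷ []
μimg a b = a ∷ b ∷ []
μimg b a = b ∷ a ∷ []
μimg b b = b ∷ []

μ : Letter → Word → Word
μ x = concatMap (μimg x)

μ̃ : Letter → Word → Word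
μ̃ x = concatMap (reverse ∘ μimg x)

μ-++ : ∀ x u v → μ x (u ++ v) ≡ μ x u ++ μ x v
μ-++ x = concatMap-++ (μimg x)

μ̃-++ : ∀ x u v → μ̃ x (u ++ v) ≡ μ̃ x u ++ μ̃ x v
μ̃-++ x = concatMap-++ (reverse ∘ μimg x)

μ-other : ∀ x s → μ x (other x ∷ s) ≡ x ∷ other x ∷ μ x s
μ-other a s = refl
μ-other b s = refl

μ-∷ʳ-self : ∀ x p → μ x (p ++ [ x ]) ++ [ x ] ≡ (μ x p ++ [ x ]) ++ [ x ]
μ-∷ʳ-self a p = cong (_++ [ a ]) (μ-++ a p [ a ])
μ-∷ʳ-self b p = cong (_++ [ b ]) (μ-++ b p [ b ])

μ-∷ʳ-other : ∀ x p → μ x (p ++ [ other x ]) ≡ (μ x p ++ [ x ]) ++ [ other x ]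
μ-∷ʳ-other x p = begin
  μ x (p ++ [ other x ])              ≡⟨ μ-++ x p [ other x ] ⟩
  μ x p ++ μ x [ other x ]            ≡⟨ cong (μ x p ++_) (μ-other x []) ⟩
  μ x p ++ x ∷ other x ∷ []           ≡⟨ ++-assoc (μ x p) [ x ] [ other x ] ⟨
  (μ x p ++ [ x ]) ++ [ other x ]     ∎
  where open ≡-Reasoning

μ-conjugate : ∀ x w → μ x w ++ [ x ] ≡ x ∷ μ̃ x w
μ-conjugate x       []      = refl
μ-conjugate a (a ∷ w) = cong (a ∷_) (μ-conjugate a w)
μ-conjugate a (b ∷ w) = cong (λ v → a ∷ b ∷ v) (μ-conjugate a w)
μ-conjugate b (a ∷ w) = cong (λ v → b ∷ a ∷ v) (μ-conjugate b w)
μ-conjugate b (b ∷ w) = cong (b ∷_) (μ-conjugate b w)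

-- A left inverse of μ̃ x, read left to right: in μ̃ x w the other letter is always followed
-- by an x, which is skipped; the last clause only handles words outside the image.
μ̃⁻¹ : Letter → Word → Word
μ̃⁻¹ x []            = []
μ̃⁻¹ a (a ∷ w)       = a ∷ μ̃⁻¹ a w
μ̃⁻¹ a (b ∷ _ ∷ w)   = b ∷ μ̃⁻¹ a w
μ̃⁻¹ b (b ∷ w)       = b ∷ μ̃⁻¹ b w
μ̃⁻¹ b (a ∷ _ ∷ w)   = a ∷ μ̃⁻¹ b w
μ̃⁻¹ x (_ ∷ [])      = []

μ̃⁻¹-μ̃ : ∀ x w → μ̃⁻¹ x (μ̃ x w) ≡ w
μ̃⁻¹-μ̃ x []      = refl
μ̃⁻¹-μ̃ a (a ∷ w) = cong (a ∷_) (μ̃⁻¹-μ̃ a w)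
μ̃⁻¹-μ̃ a (b ∷ w) = cong (b ∷_) (μ̃⁻¹-μ̃ a w)
μ̃⁻¹-μ̃ b (a ∷ w) = cong (a ∷_) (μ̃⁻¹-μ̃ b w)
μ̃⁻¹-μ̃ b (b ∷ w) = cong (b ∷_) (μ̃⁻¹-μ̃ b w)

μ-injective : ∀ x u w → μ x u ≡ μ x w → u ≡ w
μ-injective x u w eq = reverse-injective (begin
  reverse u                         ≡⟨ μ̃⁻¹-μ̃ x (reverse u) ⟨
  μ̃⁻¹ x (μ̃ x (reverse u))          ≡⟨ cong (μ̃⁻¹ x) (reverse-concatMap (μimg x) u) ⟨
  μ̃⁻¹ x (reverse (μ x u))          ≡⟨ cong (μ̃⁻¹ x ∘ reverse) eq ⟩
  μ̃⁻¹ x (reverse (μ x w))          ≡⟨ cong (μ̃⁻¹ x) (reverse-concatMap (μimg x) w) ⟩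
  μ̃⁻¹ x (μ̃ x (reverse w))          ≡⟨ μ̃⁻¹-μ̃ x (reverse w) ⟩
  reverse w                         ∎)
  where open ≡-Reasoning

reverse-μ∷ʳ : ∀ x s → reverse (μ x s ++ [ x ]) ≡ μ x (reverse s) ++ [ x ]
reverse-μ∷ʳ x s = begin
  reverse (μ x s ++ [ x ])    ≡⟨ reverse-++ (μ x s) [ x ] ⟩
  x ∷ reverse (μ x s)         ≡⟨ cong (x ∷_) (reverse-concatMap (μimg x) s) ⟩
  x ∷ μ̃ x (reverse s)         ≡⟨ μ-conjugate x (reverse s) ⟨
  μ x (reverse s) ++ [ x ]    ∎
  where open ≡-Reasoning

μ∷ʳ-pal : ∀ x s → Pal s → Pal (μ x s ++ [ x ])
μ∷ʳ-pal x s pal = trans (reverse-μ∷ʳ x s) (cong (λ v → μ x v ++ [ x ]) pal)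

μ∷ʳ-pal⁻¹ : ∀ x s → Pal (μ x s ++ [ x ]) → Pal s
μ∷ʳ-pal⁻¹ x s pal = μ-injective x (reverse s) s (∷ʳ-injectiveˡ _ _ (trans (sym (reverse-μ∷ʳ x s)) pal))

μ∷ʳ-++-reverse : ∀ x t s → μ x (t ++ s ++ reverse t) ++ [ x ] ≡ μ x t ++ μ x s ++ x ∷ reverse (μ x t)
μ∷ʳ-++-reverse x t s = begin
  μ x (t ++ s ++ reverse t) ++ [ x ]                 ≡⟨ cong (_++ [ x ]) (μ-++ x t (s ++ reverse t)) ⟩
  (μ x t ++ μ x (s ++ reverse t)) ++ [ x ]           ≡⟨ cong (λ v → (μ x t ++ v) ++ [ x ]) (μ-++ x s (reverse t)) ⟩
  (μ x t ++ μ x s ++ μ x (reverse t)) ++ [ x ]       ≡⟨ ++-assoc (μ x t) _ [ x ] ⟩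
  μ x t ++ (μ x s ++ μ x (reverse t)) ++ [ x ]       ≡⟨ cong (μ x t ++_) (++-assoc (μ x s) _ [ x ]) ⟩
  μ x t ++ μ x s ++ μ x (reverse t) ++ [ x ]         ≡⟨ cong (λ v → μ x t ++ μ x s ++ v) (μ-conjugate x (reverse t)) ⟩
  μ x t ++ μ x s ++ x ∷ μ̃ x (reverse t)              ≡⟨ cong (λ v → μ x t ++ μ x s ++ x ∷ v) (reverse-concatMap (μimg x) t) ⟨
  μ x t ++ μ x s ++ x ∷ reverse (μ x t)              ∎
  where open ≡-Reasoning

-- Every letter image under μ x begins with x, so the suffixes of μ x z starting at an x
-- are exactly the images of the suffixes of z.
μ∷ʳ-suffix : ∀ x z t r → μ x z ++ [ x ] ≡ t ++ x ∷ r →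
             ∃₂ λ t′ s′ → z ≡ t′ ++ s′ × x ∷ r ≡ μ x s′ ++ [ x ]
μ∷ʳ-suffix x []      []      _ refl = [] , [] , refl , refl
μ∷ʳ-suffix x []      (_ ∷ t) r eq   = ⊥-elim (nonempty-suffix t x r (∷-injectiveʳ eq))
μ∷ʳ-suffix x (c ∷ z) []      r eq   = [] , c ∷ z , refl , sym eq
μ∷ʳ-suffix a (a ∷ z) (_ ∷ t) r eq with μ∷ʳ-suffix a z t r (∷-injectiveʳ eq)
... | t′ , s′ , z≡ , r≡ = a ∷ t′ , s′ , cong (a ∷_) z≡ , r≡
μ∷ʳ-suffix b (b ∷ z) (_ ∷ t) r eq with μ∷ʳ-suffix b z t r (∷-injectiveʳ eq)
... | t′ , s′ , z≡ , r≡ = b ∷ t′ , s′ , cong (b ∷_) z≡ , r≡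
μ∷ʳ-suffix a (b ∷ z) (_ ∷ []) r eq with ∷-injectiveˡ (∷-injectiveʳ eq)
... | ()
μ∷ʳ-suffix b (a ∷ z) (_ ∷ []) r eq with ∷-injectiveˡ (∷-injectiveʳ eq)
... | ()
μ∷ʳ-suffix a (b ∷ z) (_ ∷ _ ∷ t) r eq with μ∷ʳ-suffix a z t r (∷-injectiveʳ (∷-injectiveʳ eq))
... | t′ , s′ , z≡ , r≡ = b ∷ t′ , s′ , cong (b ∷_) z≡ , r≡
μ∷ʳ-suffix b (a ∷ z) (_ ∷ _ ∷ t) r eq with μ∷ʳ-suffix b z t r (∷-injectiveʳ (∷-injectiveʳ eq))
... | t′ , s′ , z≡ , r≡ = a ∷ t′ , s′ , cong (a ∷_) z≡ , r≡

μ-suffix : ∀ x z t r → μ x z ≡ t ++ other x ∷ r →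
           ∃₂ λ t′ s′ → z ≡ t′ ++ s′ × x ∷ other x ∷ r ≡ μ x s′
μ-suffix x []      t r eq = ⊥-elim (nonempty-suffix t (other x) r eq)
μ-suffix a (a ∷ z) [] r ()
μ-suffix a (b ∷ z) [] r ()
μ-suffix b (a ∷ z) [] r ()
μ-suffix b (b ∷ z) [] r ()
μ-suffix a (a ∷ z) (_ ∷ t) r eq with μ-suffix a z t r (∷-injectiveʳ eq)
... | t′ , s′ , z≡ , r≡ = a ∷ t′ , s′ , cong (a ∷_) z≡ , r≡
μ-suffix b (b ∷ z) (_ ∷ t) r eq with μ-suffix b z t r (∷-injectiveʳ eq)
... | t′ , s′ , z≡ , r≡ = b ∷ t′ , s′ , cong (b ∷_) z≡ , r≡
μ-suffix a (b ∷ z) (_ ∷ []) r eq = [] , b ∷ z , refl , cong (λ v → a ∷ b ∷ v) (sym (∷-injectiveʳ (∷-injectiveʳ eq)))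
μ-suffix b (a ∷ z) (_ ∷ []) r eq = [] , a ∷ z , refl , cong (λ v → b ∷ a ∷ v) (sym (∷-injectiveʳ (∷-injectiveʳ eq)))
μ-suffix a (b ∷ z) (_ ∷ _ ∷ t) r eq with μ-suffix a z t r (∷-injectiveʳ (∷-injectiveʳ eq))
... | t′ , s′ , z≡ , r≡ = b ∷ t′ , s′ , cong (b ∷_) z≡ , r≡
μ-suffix b (a ∷ z) (_ ∷ _ ∷ t) r eq with μ-suffix b z t r (∷-injectiveʳ (∷-injectiveʳ eq))
... | t′ , s′ , z≡ , r≡ = a ∷ t′ , s′ , cong (a ∷_) z≡ , r≡

-- Justin's formula

longestPalSuffix-μ∷ʳ : ∀ x {w t s} → LongestPalSuffix w t s →
                       LongestPalSuffix (μ x w ++ [ x ]) (μ x t) (μ x s ++ [ x ])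
longestPalSuffix-μ∷ʳ x {w} {t} {s} lps = record
  { split      = trans (cong (λ v → μ x v ++ [ x ]) split)
                   (trans (cong (_++ [ x ]) (μ-++ x t s)) (++-assoc (μ x t) (μ x s) [ x ]))
  ; palindrome = μ∷ʳ-pal x s palindrome
  ; longest    = longest′
  }
  where
  open LongestPalSuffix lps
  longest′ : ∀ t′ s′ → μ x w ++ [ x ] ≡ t′ ++ s′ → Pal s′ → ∃ λ r → μ x s ++ [ x ] ≡ r ++ s′
  longest′ t′ []      _  _   = μ x s ++ [ x ] , sym (++-identityʳ _)
  longest′ t′ (c ∷ r) eq pal with palSuffix-head (μ x w) x t′ c r eq pal
  ... | refl with μ∷ʳ-suffix x w t′ r eq
  ... | t″ , s″ , w≡ , r≡ with longest t″ s″ w≡ (μ∷ʳ-pal⁻¹ x s″ (subst Pal r≡ pal))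
  ... | r₀ , s≡ = μ x r₀ , (begin
    μ x s ++ [ x ]               ≡⟨ cong (λ v → μ x v ++ [ x ]) s≡ ⟩
    μ x (r₀ ++ s″) ++ [ x ]      ≡⟨ cong (_++ [ x ]) (μ-++ x r₀ s″) ⟩
    (μ x r₀ ++ μ x s″) ++ [ x ]  ≡⟨ ++-assoc (μ x r₀) (μ x s″) [ x ] ⟩
    μ x r₀ ++ μ x s″ ++ [ x ]    ≡⟨ cong (μ x r₀ ++_) r≡ ⟨
    μ x r₀ ++ x ∷ r              ∎)
    where open ≡-Reasoning

longestPalSuffix-μ : ∀ x {p t s} → LongestPalSuffix (p ++ [ other x ]) t (other x ∷ s) →
                     LongestPalSuffix (μ x (p ++ [ other x ])) (μ x t ++ [ x ]) (other x ∷ μ x s)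
longestPalSuffix-μ x {p} {t} {s} lps = record
  { split      = begin
      μ x w                               ≡⟨ cong (μ x) split ⟩
      μ x (t ++ other x ∷ s)              ≡⟨ μ-++ x t (other x ∷ s) ⟩
      μ x t ++ μ x (other x ∷ s)          ≡⟨ cong (μ x t ++_) (μ-other x s) ⟩
      μ x t ++ x ∷ other x ∷ μ x s        ≡⟨ ++-assoc (μ x t) [ x ] _ ⟨
      (μ x t ++ [ x ]) ++ other x ∷ μ x s ∎
  ; palindrome = pal-unwrap x S (subst (λ v → Pal (v ++ [ x ])) (μ-other x s) (μ∷ʳ-pal x _ palindrome))
  ; longest    = longest′
  }
  where
  open ≡-Reasoning
  open LongestPalSuffix lps
  w = p ++ [ other x ]
  S = other x ∷ μ x s
  longest′ : ∀ t′ s′ → μ x w ≡ t′ ++ s′ → Pal s′ → ∃ λ r → S ≡ r ++ s′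
  longest′ t′ []      _  _   = S , sym (++-identityʳ S)
  longest′ t′ (c ∷ r) eq pal with palSuffix-head (μ x p ++ [ x ]) (other x) t′ c r (trans (sym (μ-∷ʳ-other x p)) eq) pal
  ... | refl with μ-suffix x w t′ r eq
  ... | t″ , s″ , w≡ , r≡ with longest t″ s″ w≡ (μ∷ʳ-pal⁻¹ x s″ (subst (λ v → Pal (v ++ [ x ])) r≡ (pal-wrap x (c ∷ r) pal)))
  ... | r₀ , s≡ = ∷-suffix x S (c ∷ r) (μ x r₀) (begin
    x ∷ S                    ≡⟨ μ-other x s ⟨
    μ x (other x ∷ s)        ≡⟨ cong (μ x) s≡ ⟩
    μ x (r₀ ++ s″)           ≡⟨ μ-++ x r₀ s″ ⟩
    μ x r₀ ++ μ x s″         ≡⟨ cong (μ x r₀ ++_) r≡ ⟨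
    μ x r₀ ++ x ∷ c ∷ r      ∎)

palClosure-μ∷ʳ : ∀ x w → palClosure (μ x w ++ [ x ]) ≡ μ x (palClosure w) ++ [ x ]
palClosure-μ∷ʳ x w with longestPalSuffix w
... | t , s , lps = begin
  palClosure (μ x w ++ [ x ])                      ≡⟨ palClosure-longestPalSuffix (longestPalSuffix-μ∷ʳ x lps) ⟩
  μ x t ++ (μ x s ++ [ x ]) ++ reverse (μ x t)     ≡⟨ cong (μ x t ++_) (++-assoc (μ x s) [ x ] _) ⟩
  μ x t ++ μ x s ++ x ∷ reverse (μ x t)            ≡⟨ μ∷ʳ-++-reverse x t s ⟨
  μ x (t ++ s ++ reverse t) ++ [ x ]               ≡⟨ cong (λ v → μ x v ++ [ x ]) (palClosure-longestPalSuffix lps) ⟨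
  μ x (palClosure w) ++ [ x ]                      ∎
  where open ≡-Reasoning

palClosure-μ-∷ʳother : ∀ x p → palClosure (μ x (p ++ [ other x ])) ≡ μ x (palClosure (p ++ [ other x ])) ++ [ x ]
palClosure-μ-∷ʳother x p with longestPalSuffix (p ++ [ other x ])
... | t , s , lps with longestPalSuffix-∷ʳ lps
... | s₁ , refl = begin
  palClosure (μ x (p ++ [ other x ]))                                    ≡⟨ palClosure-longestPalSuffix (longestPalSuffix-μ x lps) ⟩
  (μ x t ++ [ x ]) ++ (other x ∷ μ x s₁) ++ reverse (μ x t ++ [ x ])     ≡⟨ cong (λ v → (μ x t ++ [ x ]) ++ (other x ∷ μ x s₁) ++ v)
                                                                              (reverse-++ (μ x t) [ x ]) ⟩
  (μ x t ++ [ x ]) ++ (other x ∷ μ x s₁) ++ x ∷ reverse (μ x t)          ≡⟨ ++-assoc (μ x t) [ x ] _ ⟩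
  μ x t ++ (x ∷ other x ∷ μ x s₁) ++ x ∷ reverse (μ x t)                 ≡⟨ cong (λ v → μ x t ++ v ++ x ∷ reverse (μ x t)) (μ-other x s₁) ⟨
  μ x t ++ μ x (other x ∷ s₁) ++ x ∷ reverse (μ x t)                     ≡⟨ μ∷ʳ-++-reverse x t (other x ∷ s₁) ⟨
  μ x (t ++ (other x ∷ s₁) ++ reverse t) ++ [ x ]                        ≡⟨ cong (λ v → μ x v ++ [ x ]) (palClosure-longestPalSuffix lps) ⟨
  μ x (palClosure (p ++ [ other x ])) ++ [ x ]                           ∎
  where open ≡-Reasoning

palClosure-μ∷ʳ-∷ʳ : ∀ x y p → palClosure ((μ x p ++ [ x ]) ++ [ y ]) ≡ μ x (palClosure (p ++ [ y ])) ++ [ x ]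
palClosure-μ∷ʳ-∷ʳ a a p = trans (cong palClosure (sym (μ-∷ʳ-self a p))) (palClosure-μ∷ʳ a (p ++ [ a ]))
palClosure-μ∷ʳ-∷ʳ b b p = trans (cong palClosure (sym (μ-∷ʳ-self b p))) (palClosure-μ∷ʳ b (p ++ [ b ]))
palClosure-μ∷ʳ-∷ʳ a b p = trans (cong palClosure (sym (μ-∷ʳ-other a p))) (palClosure-μ-∷ʳother a p)
palClosure-μ∷ʳ-∷ʳ b a p = trans (cong palClosure (sym (μ-∷ʳ-other b p))) (palClosure-μ-∷ʳother b p)

ψrev-∷ʳ : ∀ r x → ψrev (r ++ [ x ]) ≡ μ x (ψrev r) ++ [ x ]
ψrev-∷ʳ []      a = refl
ψrev-∷ʳ []      b = refl
ψrev-∷ʳ (y ∷ r) x = trans (cong (λ v → palClosure (v ++ [ y ])) (ψrev-∷ʳ r x)) (palClosure-μ∷ʳ-∷ʳ x y (ψrev r))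

ψ-∷ : ∀ x v → ψ (x ∷ v) ≡ μ x (ψ v) ++ [ x ]
ψ-∷ x v = trans (cong ψrev (unfold-reverse x v)) (ψrev-∷ʳ (reverse v) x)

-- φ_k and φ̂_k as composites of μ_a and μ̃_b

IsMorphism : (Word → Word) → Set
IsMorphism f = ∀ u v → f (u ++ v) ≡ f u ++ f v

morphism-[] : ∀ {f} → IsMorphism f → f [] ≡ []
morphism-[] {f} hom = ++-identityʳ-unique (f []) (hom [] [])

fold-morphism : ∀ {f} → IsMorphism f → ∀ k → IsMorphism (λ w → fold w f k)
fold-morphism     hom zero    u v = refl
fold-morphism {f} hom (suc k) u v = trans (cong f (fold-morphism hom k u v)) (hom (fold u f k) (fold v f k))

morphism-concatMap : ∀ {f} g → IsMorphism f → (∀ c → f [ c ] ≡ g c) → ∀ w → f w ≡ concatMap g w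
morphism-concatMap {f} g hom images []      = morphism-[] {f} hom
morphism-concatMap     g hom images (c ∷ w) = trans (hom [ c ] w) (cong₂ _++_ (images c) (morphism-concatMap g hom images w))

fold-μa-a : ∀ k → fold [ a ] (μ a) k ≡ [ a ]
fold-μa-a zero    = refl
fold-μa-a (suc k) = cong (μ a) (fold-μa-a k)

fold-μa-b : ∀ k → fold [ b ] (μ a) k ≡ replicate k a ++ [ b ]
fold-μa-b zero    = refl
fold-μa-b (suc k) = trans (cong (μ a) (fold-μa-b k)) (μa-aᵏb k)
  where
  μa-aᵏb : ∀ k → μ a (replicate k a ++ [ b ]) ≡ a ∷ replicate k a ++ [ b ]
  μa-aᵏb zero    = refl
  μa-aᵏb (suc k) = cong (a ∷_) (μa-aᵏb k)

fold-μ̃b-a : ∀ k → fold [ a ] (μ̃ b) k ≡ a ∷ replicate k b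
fold-μ̃b-a zero    = refl
fold-μ̃b-a (suc k) = trans (cong (μ̃ b) (fold-μ̃b-a k)) (cong (λ v → a ∷ b ∷ v) (μ̃b-bᵏ k))
  where
  μ̃b-bᵏ : ∀ k → μ̃ b (replicate k b) ≡ replicate k b
  μ̃b-bᵏ zero    = refl
  μ̃b-bᵏ (suc k) = cong (b ∷_) (μ̃b-bᵏ k)

fold-μ̃b-b : ∀ k → fold [ b ] (μ̃ b) k ≡ [ b ]
fold-μ̃b-b zero    = refl
fold-μ̃b-b (suc k) = cong (μ̃ b) (fold-μ̃b-b k)

φ-fold : ∀ k w → φ k w ≡ fold (μ̃ b w) (μ a) k
φ-fold k w = sym (morphism-concatMap (φimg k) hom images w)
  where
  hom : IsMorphism (λ w → fold (μ̃ b w) (μ a) k)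
  hom u v = trans (cong (λ w → fold w (μ a) k) (μ̃-++ b u v))
                  (fold-morphism (μ-++ a) k (μ̃ b u) (μ̃ b v))
  images : ∀ c → fold (μ̃ b [ c ]) (μ a) k ≡ φimg k c
  images a = trans (fold-morphism (μ-++ a) k [ a ] [ b ]) (cong₂ _++_ (fold-μa-a k) (fold-μa-b k))
  images b = fold-μa-b k

φ̂-fold : ∀ k w → φ̂ k w ≡ fold (μ a w) (μ̃ b) k
φ̂-fold k w = sym (morphism-concatMap (φ̂img k) hom images w)
  where
  hom : IsMorphism (λ w → fold (μ a w) (μ̃ b) k)
  hom u v = trans (cong (λ w → fold w (μ̃ b) k) (μ-++ a u v))
                  (fold-morphism (μ̃-++ b) k (μ a u) (μ a v))
  images : ∀ c → fold (μ a [ c ]) (μ̃ b) k ≡ φ̂img k c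
  images a = fold-μ̃b-a k
  images b = begin
    fold (a ∷ b ∷ []) (μ̃ b) k                ≡⟨ fold-morphism (μ̃-++ b) k [ a ] [ b ] ⟩
    fold [ a ] (μ̃ b) k ++ fold [ b ] (μ̃ b) k ≡⟨ cong₂ _++_ (fold-μ̃b-a k) (fold-μ̃b-b k) ⟩
    a ∷ replicate k b ++ [ b ]               ≡⟨ cong (a ∷_) (replicate-∷ʳ k b) ⟩
    a ∷ b ∷ replicate k b                    ∎
    where open ≡-Reasoning

-- Christoffel words and their derivatives

christoffel : Word → Word
christoffel v = a ∷ ψ v ++ [ b ]

christoffel-a∷ : ∀ v → christoffel (a ∷ v) ≡ μ a (christoffel v)
christoffel-a∷ v = cong (a ∷_) (begin
  ψ (a ∷ v) ++ [ b ]             ≡⟨ cong (_++ [ b ]) (ψ-∷ a v) ⟩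
  (μ a (ψ v) ++ [ a ]) ++ [ b ]  ≡⟨ ++-assoc (μ a (ψ v)) [ a ] [ b ] ⟩
  μ a (ψ v) ++ μ a [ b ]         ≡⟨ μ-++ a (ψ v) [ b ] ⟨
  μ a (ψ v ++ [ b ])             ∎)
  where open ≡-Reasoning

christoffel-b∷ : ∀ v → christoffel (b ∷ v) ≡ μ̃ b (christoffel v)
christoffel-b∷ v = cong (a ∷_) (begin
  ψ (b ∷ v) ++ [ b ]             ≡⟨ cong (_++ [ b ]) (ψ-∷ b v) ⟩
  (μ b (ψ v) ++ [ b ]) ++ [ b ]  ≡⟨ cong (_++ [ b ]) (μ-conjugate b (ψ v)) ⟩
  b ∷ μ̃ b (ψ v) ++ [ b ]         ≡⟨ cong (b ∷_) (μ̃-++ b (ψ v) [ b ]) ⟨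
  b ∷ μ̃ b (ψ v ++ [ b ])         ∎)
  where open ≡-Reasoning

christoffel-aᵏ : ∀ k u → christoffel (replicate k a ++ u) ≡ fold (christoffel u) (μ a) k
christoffel-aᵏ zero    u = refl
christoffel-aᵏ (suc k) u = trans (christoffel-a∷ (replicate k a ++ u)) (cong (μ a) (christoffel-aᵏ k u))

christoffel-bᵏ : ∀ k u → christoffel (replicate k b ++ u) ≡ fold (christoffel u) (μ̃ b) k
christoffel-bᵏ zero    u = refl
christoffel-bᵏ (suc k) u = trans (christoffel-b∷ (replicate k b ++ u)) (cong (μ̃ b) (christoffel-bᵏ k u))

runLength-split : ∀ x v → ∃ λ u → v ≡ replicate (runLength x v) x ++ u × runLength x u ≡ 0
runLength-split x []      = [] , refl , refl
runLength-split a (b ∷ v) = b ∷ v , refl , refl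
runLength-split b (a ∷ v) = a ∷ v , refl , refl
runLength-split a (a ∷ v) with runLength-split a v
... | u , v≡ , u₀ = u , cong (a ∷_) v≡ , u₀
runLength-split b (b ∷ v) with runLength-split b v
... | u , v≡ , u₀ = u , cong (b ∷_) v≡ , u₀

μ̃b-preimage : ∀ u → runLength a u ≡ 0 → ∃ λ d → μ̃ b d ≡ christoffel u × IsChristoffel d
μ̃b-preimage []      _ = [ a ] , refl , inj₁ refl
μ̃b-preimage (b ∷ u) _ = christoffel u , sym (christoffel-b∷ u) , inj₂ (inj₂ (u , refl))

μa-preimage : ∀ u → runLength b u ≡ 0 → ∃ λ d → μ a d ≡ christoffel u × IsChristoffel d
μa-preimage []      _ = [ b ] , refl , inj₂ (inj₁ refl)
μa-preimage (a ∷ u) _ = christoffel u , sym (christoffel-a∷ u) , inj₂ (inj₂ (u , refl))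

derivative-a : ∀ v → ∃ λ d → φ (runLength a v) d ≡ christoffel v × IsChristoffel d
derivative-a v with runLength-split a v
... | u , v≡ , u₀ with μ̃b-preimage u u₀
... | d , μ̃d≡ , chr = d , (begin
  φ k d                             ≡⟨ φ-fold k d ⟩
  fold (μ̃ b d) (μ a) k              ≡⟨ cong (λ w → fold w (μ a) k) μ̃d≡ ⟩
  fold (christoffel u) (μ a) k      ≡⟨ christoffel-aᵏ k u ⟨
  christoffel (replicate k a ++ u)  ≡⟨ cong christoffel v≡ ⟨
  christoffel v                     ∎) , chr
  where
  open ≡-Reasoning
  k = runLength a v

derivative-b : ∀ v → ∃ λ d → φ̂ (runLength b v) d ≡ christoffel v × IsChristoffel d
derivative-b v with runLength-split b v
... | u , v≡ , u₀ with μa-preimage u u₀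
... | d , μd≡ , chr = d , (begin
  φ̂ k d                             ≡⟨ φ̂-fold k d ⟩
  fold (μ a d) (μ̃ b) k              ≡⟨ cong (λ w → fold w (μ̃ b) k) μd≡ ⟩
  fold (christoffel u) (μ̃ b) k      ≡⟨ christoffel-bᵏ k u ⟨
  christoffel (replicate k b ++ u)  ≡⟨ cong christoffel v≡ ⟨
  christoffel v                     ∎) , chr
  where
  open ≡-Reasoning
  k = runLength b v

mainTheorem1 : (v : Word) → ∃ λ d → IsDerivative v d × IsChristoffel d
mainTheorem1 []      = [ a ] , refl , inj₁ refl
mainTheorem1 (a ∷ v) = derivative-a (a ∷ v)
mainTheorem1 (b ∷ v) = derivative-b (b ∷ v)
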